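{- If $\mathcal G$ is a hereditary class of graphs, then $\mathcal G^\&$ is hereditary.
   Context: A class $\mathcal G$ of graphs is hereditary if for every $G\in\mathcal G$, every graph isomorphic to an induced subgraph of $G$ belongs to $\mathcal G$. For graphs $G_1,G_2$ with $|V(G_1)|,|V(G_2)|\ge 3$ and $V(G_1)\cap V(G_2)=\emptyset$, and vertices $v_1\in V(G_1)$, $v_2\in V(G_2)$, the $1$-join of $(G_1,v_1)$ and $(G_2,v_2)$ is the graph obtained from the disjoint union of $G_1$ and $G_2$ by deleting $v_1$ and $v_2$ and adding all edges between every neighbor of $v_1$ in $G_1$ and every neighbor of $v_2$ in $G_2$. $\mathcal G^\&$ denotes the closure of $\mathcal G$ under disjoint union and $1$-join. -}

module Defs where

open import Data.Nat using (ℕ; zero; suc; _+_; _≤_)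
open import Data.Fin using (Fin; splitAt; punchIn)
open import Data.Bool using (Bool; false; _∧_)
open import Data.Bool.Properties using (∧-comm)
open import Data.Sum using (_⊎_; inj₁; inj₂)
open import Data.Product using (Σ)
open import Function.Bundles using (_↔_; _↣_; Inverse; Injection)
open import Relation.Binary.PropositionalEquality using (_≡_; refl)

record Graph : Set where
  constructor mkGraph
  field
    n     : ℕ
    adj   : Fin n → Fin n → Bool
    adj-sym : ∀ i j → adj i j ≡ adj j i
    adj-irr : ∀ i → adj i i ≡ false

open Graph public

GraphClass : Set₁
GraphClass = Graph → Set

_≅_ : Graph → Graph → Set
G ≅ H = Σ (Fin (n G) ↔ Fin (n H))
          (λ f → ∀ i j → adj H (Inverse.to f i) (Inverse.to f j) ≡ adj G i j)

induced : (G : Graph) {k : ℕ} → Fin k ↣ Fin (n G) → Graph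
induced G {k} e = mkGraph k (λ i j → adj G (f i) (f j))
                    (λ i j → adj-sym G (f i) (f j)) (λ i → adj-irr G (f i))
  where f = Injection.to e

Hereditary : GraphClass → Set
Hereditary 𝒢 = ∀ G → 𝒢 G → ∀ {k} (e : Fin k ↣ Fin (n G)) → ∀ H → H ≅ induced G e → 𝒢 H

-- Generic gluing of two graphs on the vertex set Fin (n₁ + n₂) (first n₁
-- vertices from G₁, the rest from G₂), with cross edges between a ∈ G₁ and
-- b ∈ G₂ exactly when c₁ a ∧ c₂ b.
module _ (G₁ G₂ : Graph) (c₁ : Fin (n G₁) → Bool) (c₂ : Fin (n G₂) → Bool) where
  private
    adjS : Fin (n G₁) ⊎ Fin (n G₂) → Fin (n G₁) ⊎ Fin (n G₂) → Bool
    adjS (inj₁ a) (inj₁ b) = adj G₁ a b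
    adjS (inj₂ a) (inj₂ b) = adj G₂ a b
    adjS (inj₁ a) (inj₂ b) = c₁ a ∧ c₂ b
    adjS (inj₂ b) (inj₁ a) = c₁ a ∧ c₂ b

    symS : ∀ x y → adjS x y ≡ adjS y x
    symS (inj₁ a) (inj₁ b) = adj-sym G₁ a b
    symS (inj₂ a) (inj₂ b) = adj-sym G₂ a b
    symS (inj₁ a) (inj₂ b) = refl
    symS (inj₂ b) (inj₁ a) = refl

    irrS : ∀ x → adjS x x ≡ false
    irrS (inj₁ a) = adj-irr G₁ a
    irrS (inj₂ a) = adj-irr G₂ a

  glue : Graph
  glue = mkGraph (n G₁ + n G₂)
           (λ i j → adjS (splitAt (n G₁) i) (splitAt (n G₁) j))
           (λ i j → symS (splitAt (n G₁) i) (splitAt (n G₁) j))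
           (λ i → irrS (splitAt (n G₁) i))

_⊕_ : Graph → Graph → Graph
G₁ ⊕ G₂ = glue G₁ G₂ (λ _ → false) (λ _ → false)

delete : (G : Graph) → Fin (n G) → Graph
delete (mkGraph (suc k) a s r) v =
  mkGraph k (λ i j → a (punchIn v i) (punchIn v j))
            (λ i j → s (punchIn v i) (punchIn v j)) (λ i → r (punchIn v i))

nbrOf : (G : Graph) (v : Fin (n G)) → Fin (n (delete G v)) → Bool
nbrOf (mkGraph (suc k) a s r) v i = a v (punchIn v i)

oneJoin : (G₁ : Graph) → Fin (n G₁) → (G₂ : Graph) → Fin (n G₂) → Graph
oneJoin G₁ v₁ G₂ v₂ = glue (delete G₁ v₁) (delete G₂ v₂) (nbrOf G₁ v₁) (nbrOf G₂ v₂)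

-- 𝒢^& : the closure of 𝒢 under disjoint union and 1-join (graphs taken up
-- to isomorphism, as vertex sets are abstract in the paper).
data Closure (𝒢 : GraphClass) : Graph → Set where
  base  : ∀ {G} → 𝒢 G → Closure 𝒢 G
  union : ∀ {G₁ G₂} → Closure 𝒢 G₁ → Closure 𝒢 G₂ → Closure 𝒢 (G₁ ⊕ G₂)
  join  : ∀ {G₁ G₂} → Closure 𝒢 G₁ → Closure 𝒢 G₂ → 3 ≤ n G₁ → 3 ≤ n G₂ →
          (v₁ : Fin (n G₁)) (v₂ : Fin (n G₂)) → Closure 𝒢 (oneJoin G₁ v₁ G₂ v₂)
  iso   : ∀ {G H} → Closure 𝒢 G → G ≅ H → Closure 𝒢 H

module Submission where

-- We show, by induction on the derivation of 'Closure 𝒢 G', that Closure 𝒢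
-- contains every induced subgraph 'induced G e'; heredity then follows since
-- Closure 𝒢 is closed under isomorphism.  Disjoint union and 1-join are both
-- instances of 'glue', so the heart of the argument is:
--  * an induced subgraph of 'glue G₁ G₂ c₁ c₂' is a glue of induced
--    subgraphs Q₁ ⊆ G₁ and Q₂ ⊆ G₂ (partition its vertices by side);
--  * for a 1-join of (G₁,v₁) and (G₂,v₂), restoring vᵢ to Qᵢ ⊆ Gᵢ − vᵢ gives
--    an induced subgraph of Gᵢ, the apex graph over Qᵢ;
--  * the glue of Q₁ and Q₂ lies in the closure whenever Q₁, Q₂ and both apex
--    graphs do: it is the 1-join of the apex graphs if both Qᵢ have ≥ 2
--    vertices, and otherwise just Q₂, a disjoint union, or an apex graph.

open import Defs
open import Data.Nat using (ℕ; zero; suc; _+_; _≤_; s≤s; _≤?_)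
open import Data.Nat.Properties using (≰⇒>)
open import Data.Fin using (Fin; zero; suc; splitAt; punchIn) renaming (join to joinFin)
open import Data.Fin.Properties using (+↔⊎; splitAt-join; punchIn-injective; punchInᵢ≢i)
open import Data.Bool using (Bool; true; false; _∧_)
open import Data.Bool.Properties using (∧-comm)
open import Data.Sum using (_⊎_; inj₁; inj₂; [_,_]; map; map₁; swap)
open import Data.Sum.Properties using (inj₁-injective; inj₂-injective; swap-involutive; swap-↔)
open import Data.Product using (Σ; _,_; proj₁)
open import Data.Empty using (⊥-elim)
open import Data.Vec.Functional using (_∷_)
open import Function using (_∘_)
open import Function.Bundles using (_↔_; _↣_; Inverse; Injection; mk↔ₛ′; mk↣)
open import Function.Definitions using (Injective)
open import Function.Construct.Composition using (_↣-∘_; _↔-∘_)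
open import Function.Properties.Inverse using (↔-refl; ↔-sym; ↔⇒↣)
open import Relation.Nullary using (yes; no)
open import Relation.Binary.PropositionalEquality
  using (_≡_; _≢_; refl; sym; trans; cong; cong₂; module ≡-Reasoning)

open Inverse using (to; from; strictlyInverseˡ; strictlyInverseʳ)
open Injection using (injective)

-- Two graphs on the same vertex set Fin k with the same adjacency relation
-- are isomorphic via the identity.  (The type is G ≅ H unfolded, since _≅_
-- only inspects vertex sets and adjacency, not the symmetry/irreflexivity
-- proofs.)
≅-of-adj : ∀ {k} {A B : Fin k → Fin k → Bool} → (∀ i j → B i j ≡ A i j) →
           Σ (Fin k ↔ Fin k) (λ φ → ∀ i j → B (to φ i) (to φ j) ≡ A i j)
≅-of-adj same = ↔-refl , same

≅-refl : (G : Graph) → G ≅ G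
≅-refl G = ≅-of-adj (λ _ _ → refl)

≅-sym : (G H : Graph) → G ≅ H → H ≅ G
≅-sym G H (φ , preserves) = ↔-sym φ , reflects
  where
  reflects : ∀ i j → adj G (from φ i) (from φ j) ≡ adj H i j
  reflects i j = trans (sym (preserves (from φ i) (from φ j)))
                       (cong₂ (adj H) (strictlyInverseˡ φ i) (strictlyInverseˡ φ j))

induced-≅ : (G G′ : Graph) (φ : G ≅ G′) {k : ℕ} (e : Fin k ↣ Fin (n G′)) →
            induced G (↔⇒↣ (↔-sym (proj₁ φ)) ↣-∘ e) ≅ induced G′ e
induced-≅ G G′ (φ , preserves) e = ≅-of-adj same
  where
  same : ∀ i j → adj G′ (Injection.to e i) (Injection.to e j)
               ≡ adj G (from φ (Injection.to e i)) (from φ (Injection.to e j))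
  same i j = trans (sym (cong₂ (adj G′) (strictlyInverseˡ φ _) (strictlyInverseˡ φ _)))
                   (preserves _ _)

adj⊎ : {A B : Set} → (A → A → Bool) → (B → B → Bool) → (A → Bool) → (B → Bool) →
       A ⊎ B → A ⊎ B → Bool
adj⊎ R₁ R₂ c₁ c₂ (inj₁ a) (inj₁ a′) = R₁ a a′
adj⊎ R₁ R₂ c₁ c₂ (inj₂ b) (inj₂ b′) = R₂ b b′
adj⊎ R₁ R₂ c₁ c₂ (inj₁ a) (inj₂ b)  = c₁ a ∧ c₂ b
adj⊎ R₁ R₂ c₁ c₂ (inj₂ b) (inj₁ a)  = c₁ a ∧ c₂ b

glue-adj : ∀ G₁ G₂ c₁ c₂ (i j : Fin (n (glue G₁ G₂ c₁ c₂))) →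
           adj (glue G₁ G₂ c₁ c₂) i j
           ≡ adj⊎ (adj G₁) (adj G₂) c₁ c₂ (splitAt (n G₁) i) (splitAt (n G₁) j)
glue-adj G₁ G₂ c₁ c₂ i j with splitAt (n G₁) i | splitAt (n G₁) j
... | inj₁ _ | inj₁ _ = refl
... | inj₁ _ | inj₂ _ = refl
... | inj₂ _ | inj₁ _ = refl
... | inj₂ _ | inj₂ _ = refl

glue-adj-join : ∀ G₁ G₂ c₁ c₂ (u v : Fin (n G₁) ⊎ Fin (n G₂)) →
                adj (glue G₁ G₂ c₁ c₂) (joinFin (n G₁) (n G₂) u) (joinFin (n G₁) (n G₂) v)
                ≡ adj⊎ (adj G₁) (adj G₂) c₁ c₂ u v
glue-adj-join G₁ G₂ c₁ c₂ u v =
  trans (glue-adj G₁ G₂ c₁ c₂ _ _)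
        (cong₂ (adj⊎ (adj G₁) (adj G₂) c₁ c₂) (splitAt-join (n G₁) (n G₂) u)
                                               (splitAt-join (n G₁) (n G₂) v))

adj⊎-map : {A B A′ B′ : Set} (R₁ : A → A → Bool) (R₂ : B → B → Bool)
           (c₁ : A → Bool) (c₂ : B → Bool) (g₁ : A′ → A) (g₂ : B′ → B) (u v : A′ ⊎ B′) →
           adj⊎ (λ x y → R₁ (g₁ x) (g₁ y)) (λ x y → R₂ (g₂ x) (g₂ y)) (c₁ ∘ g₁) (c₂ ∘ g₂) u v
           ≡ adj⊎ R₁ R₂ c₁ c₂ (map g₁ g₂ u) (map g₁ g₂ v)
adj⊎-map R₁ R₂ c₁ c₂ g₁ g₂ (inj₁ _) (inj₁ _) = refl
adj⊎-map R₁ R₂ c₁ c₂ g₁ g₂ (inj₁ _) (inj₂ _) = refl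
adj⊎-map R₁ R₂ c₁ c₂ g₁ g₂ (inj₂ _) (inj₁ _) = refl
adj⊎-map R₁ R₂ c₁ c₂ g₁ g₂ (inj₂ _) (inj₂ _) = refl

adj⊎-swap : {A B : Set} (R₁ : A → A → Bool) (R₂ : B → B → Bool)
            (c₁ : A → Bool) (c₂ : B → Bool) (u v : A ⊎ B) →
            adj⊎ R₂ R₁ c₂ c₁ (swap u) (swap v) ≡ adj⊎ R₁ R₂ c₁ c₂ u v
adj⊎-swap R₁ R₂ c₁ c₂ (inj₁ _) (inj₁ _) = refl
adj⊎-swap R₁ R₂ c₁ c₂ (inj₁ a) (inj₂ b) = ∧-comm (c₂ b) (c₁ a)
adj⊎-swap R₁ R₂ c₁ c₂ (inj₂ b) (inj₁ a) = ∧-comm (c₂ b) (c₁ a)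
adj⊎-swap R₁ R₂ c₁ c₂ (inj₂ _) (inj₂ _) = refl

glue-comm : ∀ G₁ G₂ c₁ c₂ → glue G₁ G₂ c₁ c₂ ≅ glue G₂ G₁ c₂ c₁
glue-comm G₁ G₂ c₁ c₂ = φ , preserves
  where
  φ : Fin (n (glue G₁ G₂ c₁ c₂)) ↔ Fin (n (glue G₂ G₁ c₂ c₁))
  φ = ↔-sym (+↔⊎ {n G₂} {n G₁}) ↔-∘ (swap-↔ ↔-∘ +↔⊎ {n G₁} {n G₂})
  open ≡-Reasoning
  preserves : ∀ i j → adj (glue G₂ G₁ c₂ c₁) (to φ i) (to φ j) ≡ adj (glue G₁ G₂ c₁ c₂) i j
  preserves i j = begin
    adj (glue G₂ G₁ c₂ c₁) (to φ i) (to φ j)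
      ≡⟨ glue-adj-join G₂ G₁ c₂ c₁ (swap (splitAt (n G₁) i)) (swap (splitAt (n G₁) j)) ⟩
    adj⊎ (adj G₂) (adj G₁) c₂ c₁ (swap (splitAt (n G₁) i)) (swap (splitAt (n G₁) j))
      ≡⟨ adj⊎-swap (adj G₁) (adj G₂) c₁ c₂ (splitAt (n G₁) i) (splitAt (n G₁) j) ⟩
    adj⊎ (adj G₁) (adj G₂) c₁ c₂ (splitAt (n G₁) i) (splitAt (n G₁) j)
      ≡⟨ glue-adj G₁ G₂ c₁ c₂ i j ⟨
    adj (glue G₁ G₂ c₁ c₂) i j ∎

-- A partition of Fin m along F : Fin m → A ⊎ B: a bijection
-- σ : Fin a ⊎ Fin b ↔ Fin m under which F becomes map g₁ g₂, i.e. the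
-- first a elements are those sent left (via g₁), the other b those sent
-- right (via g₂).
record Partition {A B : Set} {m : ℕ} (F : Fin m → A ⊎ B) : Set where
  field
    a b    : ℕ
    g₁     : Fin a → A
    g₂     : Fin b → B
    σ      : (Fin a ⊎ Fin b) ↔ Fin m
    factor : ∀ u → F (to σ u) ≡ map g₁ g₂ u

  σ-injective : Injective _≡_ _≡_ (to σ)
  σ-injective = injective (↔⇒↣ σ)

  module _ (F-injective : Injective _≡_ _≡_ F) where
    g₁-injective : Injective _≡_ _≡_ g₁
    g₁-injective {x} {y} gx≡gy = inj₁-injective (σ-injective (F-injective
      (trans (factor (inj₁ x)) (trans (cong inj₁ gx≡gy) (sym (factor (inj₁ y)))))))

    g₂-injective : Injective _≡_ _≡_ g₂
    g₂-injective {x} {y} gx≡gy = inj₂-injective (σ-injective (F-injective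
      (trans (factor (inj₂ x)) (trans (cong inj₂ gx≡gy) (sym (factor (inj₂ y)))))))

module _ {A B : Set} where

  partition-empty : (F : Fin zero → A ⊎ B) → Partition F
  partition-empty F = record
    { a = 0 ; b = 0 ; g₁ = λ () ; g₂ = λ ()
    ; σ = mk↔ₛ′ [ (λ ()) , (λ ()) ] (λ ()) (λ ()) [ (λ ()) , (λ ()) ]
    ; factor = [ (λ ()) , (λ ()) ] }

  partition-consˡ : ∀ {m} {F : Fin (suc m) → A ⊎ B} {x : A} → F zero ≡ inj₁ x →
                    Partition (F ∘ suc) → Partition F
  partition-consˡ {m} {F} {x} F0≡x P = record
    { a = suc a ; b = b ; g₁ = x ∷ g₁ ; g₂ = g₂
    ; σ = mk↔ₛ′ to′ from′ to∘from′ from∘to′ ; factor = factor′ }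
    where
    open Partition P
    to′ : Fin (suc a) ⊎ Fin b → Fin (suc m)
    to′ (inj₁ zero)    = zero
    to′ (inj₁ (suc i)) = suc (to σ (inj₁ i))
    to′ (inj₂ j)       = suc (to σ (inj₂ j))

    from′ : Fin (suc m) → Fin (suc a) ⊎ Fin b
    from′ zero    = inj₁ zero
    from′ (suc k) = map₁ suc (from σ k)

    to′-shift : ∀ u → to′ (map₁ suc u) ≡ suc (to σ u)
    to′-shift (inj₁ _) = refl
    to′-shift (inj₂ _) = refl

    to∘from′ : ∀ k → to′ (from′ k) ≡ k
    to∘from′ zero    = refl
    to∘from′ (suc k) = trans (to′-shift (from σ k)) (cong suc (strictlyInverseˡ σ k))

    from∘to′ : ∀ u → from′ (to′ u) ≡ u
    from∘to′ (inj₁ zero)    = refl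
    from∘to′ (inj₁ (suc i)) = cong (map₁ suc) (strictlyInverseʳ σ (inj₁ i))
    from∘to′ (inj₂ j)       = cong (map₁ suc) (strictlyInverseʳ σ (inj₂ j))

    factor′ : ∀ u → F (to′ u) ≡ map (x ∷ g₁) g₂ u
    factor′ (inj₁ zero)    = F0≡x
    factor′ (inj₁ (suc i)) = factor (inj₁ i)
    factor′ (inj₂ j)       = factor (inj₂ j)

partition-swap : ∀ {A B : Set} {m} {F : Fin m → A ⊎ B} → Partition (swap ∘ F) → Partition F
partition-swap {F = F} P = record
  { a = b ; b = a ; g₁ = g₂ ; g₂ = g₁ ; σ = σ ↔-∘ swap-↔ ; factor = factor′ }
  where
  open Partition P
  swap-map-swap : ∀ u → swap (map g₁ g₂ (swap u)) ≡ map g₂ g₁ u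
  swap-map-swap (inj₁ _) = refl
  swap-map-swap (inj₂ _) = refl
  open ≡-Reasoning
  factor′ : ∀ u → F (to σ (swap u)) ≡ map g₂ g₁ u
  factor′ u = begin
    F (to σ (swap u))                ≡⟨ swap-involutive (F (to σ (swap u))) ⟨
    swap (swap (F (to σ (swap u))))  ≡⟨ cong swap (factor (swap u)) ⟩
    swap (map g₁ g₂ (swap u))        ≡⟨ swap-map-swap u ⟩
    map g₂ g₁ u                      ∎

partition : ∀ {A B : Set} {m} (F : Fin m → A ⊎ B) → Partition F
partition {m = zero}  F = partition-empty F
partition {m = suc m} F with F zero in F0
... | inj₁ _ = partition-consˡ F0 (partition (F ∘ suc))
... | inj₂ _ = partition-swap (partition-consˡ (cong swap F0) (partition (swap ∘ F ∘ suc)))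

record GlueOfInduced (G₁ G₂ : Graph) (c₁ : Fin (n G₁) → Bool) (c₂ : Fin (n G₂) → Bool)
                     (H : Graph) : Set where
  field
    a b : ℕ
    e₁  : Fin a ↣ Fin (n G₁)
    e₂  : Fin b ↣ Fin (n G₂)
    decomposition : glue (induced G₁ e₁) (induced G₂ e₂)
                         (c₁ ∘ Injection.to e₁) (c₂ ∘ Injection.to e₂) ≅ H

-- Every induced subgraph of a glue is a glue of induced subgraphs: partition
-- its vertices according to the side of the glue they lie on.
induced-glue : ∀ G₁ G₂ c₁ c₂ {k} (e : Fin k ↣ Fin (n (glue G₁ G₂ c₁ c₂))) →
               GlueOfInduced G₁ G₂ c₁ c₂ (induced (glue G₁ G₂ c₁ c₂) e)
induced-glue G₁ G₂ c₁ c₂ {k} e = record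
  { a = a ; b = b ; e₁ = mk↣ (g₁-injective side-injective)
  ; e₂ = mk↣ (g₂-injective side-injective) ; decomposition = φ , preserves }
  where
  G : Graph
  G = glue G₁ G₂ c₁ c₂
  f : Fin k → Fin (n G)
  f = Injection.to e
  side : Fin k ↣ (Fin (n G₁) ⊎ Fin (n G₂))
  side = ↔⇒↣ +↔⊎ ↣-∘ e
  side-injective : Injective _≡_ _≡_ (Injection.to side)
  side-injective = injective side
  open Partition (partition (Injection.to side))
  φ : Fin (a + b) ↔ Fin k
  φ = σ ↔-∘ +↔⊎
  K : Graph
  K = glue (induced G₁ (mk↣ (g₁-injective side-injective)))
           (induced G₂ (mk↣ (g₂-injective side-injective))) (c₁ ∘ g₁) (c₂ ∘ g₂)
  open ≡-Reasoning
  preserves : ∀ i j → adj G (f (to φ i)) (f (to φ j)) ≡ adj K i j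
  preserves i j = begin
    adj G (f (to φ i)) (f (to φ j))
      ≡⟨ glue-adj G₁ G₂ c₁ c₂ (f (to φ i)) (f (to φ j)) ⟩
    adj⊎ (adj G₁) (adj G₂) c₁ c₂ (Injection.to side (to φ i)) (Injection.to side (to φ j))
      ≡⟨ cong₂ (adj⊎ (adj G₁) (adj G₂) c₁ c₂) (factor (splitAt a i)) (factor (splitAt a j)) ⟩
    adj⊎ (adj G₁) (adj G₂) c₁ c₂ (map g₁ g₂ (splitAt a i)) (map g₁ g₂ (splitAt a j))
      ≡⟨ adj⊎-map (adj G₁) (adj G₂) c₁ c₂ g₁ g₂ (splitAt a i) (splitAt a j) ⟨
    adj⊎ (λ x y → adj G₁ (g₁ x) (g₁ y)) (λ x y → adj G₂ (g₂ x) (g₂ y)) (c₁ ∘ g₁) (c₂ ∘ g₂)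
         (splitAt a i) (splitAt a j)
      ≡⟨ glue-adj _ _ (c₁ ∘ g₁) (c₂ ∘ g₂) i j ⟨
    adj K i j ∎

K₁ : Graph
K₁ = mkGraph 1 (λ _ _ → false) (λ _ _ → refl) (λ _ → refl)

-- The apex graph over Q with link d: Q together with a new vertex 0 whose
-- neighbours are exactly the vertices selected by d.
apex : (Q : Graph) → (Fin (n Q) → Bool) → Graph
apex Q d = glue K₁ Q (λ _ → true) d

delete↣ : (G : Graph) (v : Fin (n G)) → Fin (n (delete G v)) ↣ Fin (n G)
delete↣ (mkGraph (suc _) _ _ _) v = mk↣ (λ {i} {j} → punchIn-injective v i j)

extend↣ : ∀ {X : Set} {a} (x : X) (f : Fin a ↣ X) → (∀ i → Injection.to f i ≢ x) →
          Fin (suc a) ↣ X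
extend↣ x f x∉f = mk↣ {to = x ∷ Injection.to f} extended-injective
  where
  extended-injective : Injective _≡_ _≡_ (x ∷ Injection.to f)
  extended-injective {zero}  {zero}  _  = refl
  extended-injective {zero}  {suc j} eq = ⊥-elim (x∉f j (sym eq))
  extended-injective {suc i} {zero}  eq = ⊥-elim (x∉f i eq)
  extended-injective {suc i} {suc j} eq = cong suc (injective f eq)

restore↣ : (G : Graph) (v : Fin (n G)) {a : ℕ} → Fin a ↣ Fin (n (delete G v)) →
           Fin (suc a) ↣ Fin (n G)
restore↣ G v e = extend↣ v (delete↣ G v ↣-∘ e) (λ i → v-deleted G v (Injection.to e i))
  where
  v-deleted : (G : Graph) (v : Fin (n G)) (i : Fin (n (delete G v))) →
              Injection.to (delete↣ G v) i ≢ v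
  v-deleted (mkGraph (suc _) _ _ _) v i = punchInᵢ≢i v i

induced-delete : (G : Graph) (v : Fin (n G)) {a : ℕ} (e : Fin a ↣ Fin (n (delete G v))) →
                 induced G (delete↣ G v ↣-∘ e) ≅ induced (delete G v) e
induced-delete (mkGraph (suc _) _ _ _) v e = ≅-of-adj (λ _ _ → refl)

induced-restore : (G : Graph) (v : Fin (n G)) {a : ℕ} (e : Fin a ↣ Fin (n (delete G v))) →
                  induced G (restore↣ G v e)
                  ≅ apex (induced (delete G v) e) (nbrOf G v ∘ Injection.to e)
induced-restore (mkGraph (suc k) A A-sym A-irr) v {a} e = ≅-of-adj same
  where
  f : Fin a → Fin k
  f = Injection.to e
  Q : Graph
  Q = induced (delete (mkGraph (suc k) A A-sym A-irr) v) e
  g : Fin (suc a) → Fin (suc k)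
  g = v ∷ punchIn v ∘ f
  same : ∀ i j → adj (apex Q (λ x → A v (punchIn v (f x)))) i j ≡ A (g i) (g j)
  same zero    zero    = sym (A-irr v)
  same zero    (suc j) = refl
  same (suc i) zero    = A-sym v (punchIn v (f i))
  same (suc i) (suc j) = refl

oneJoin-apex : ∀ Q₁ Q₂ d₁ d₂ → oneJoin (apex Q₁ d₁) zero (apex Q₂ d₂) zero ≅ glue Q₁ Q₂ d₁ d₂
oneJoin-apex Q₁ Q₂ d₁ d₂ = ≅-of-adj (λ i j →
  trans (glue-adj Q₁ Q₂ d₁ d₂ i j)
        (sym (glue-adj (delete (apex Q₁ d₁) zero) (delete (apex Q₂ d₂) zero) d₁ d₂ i j)))

glue-emptyˡ : ∀ {A A-sym A-irr} Q c d → Q ≅ glue (mkGraph 0 A A-sym A-irr) Q c d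
glue-emptyˡ Q c d = ≅-of-adj (λ _ _ → refl)

glue-isolatedˡ : ∀ {A A-sym A-irr} Q (c : Fin 1 → Bool) d → c zero ≡ false →
                 (mkGraph 1 A A-sym A-irr ⊕ Q) ≅ glue (mkGraph 1 A A-sym A-irr) Q c d
glue-isolatedˡ {A} {A-sym} {A-irr} Q c d c0≡false = ≅-of-adj same
  where
  P : Graph
  P = mkGraph 1 A A-sym A-irr
  same : ∀ i j → adj (glue P Q c d) i j ≡ adj (P ⊕ Q) i j
  same zero    zero    = refl
  same zero    (suc j) = cong (_∧ d j) c0≡false
  same (suc i) zero    = cong (_∧ d i) c0≡false
  same (suc i) (suc j) = refl

glue-apexˡ : ∀ {A A-sym A-irr} Q (c : Fin 1 → Bool) d → c zero ≡ true →
             apex Q d ≅ glue (mkGraph 1 A A-sym A-irr) Q c d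
glue-apexˡ {A} {A-sym} {A-irr} Q c d c0≡true = ≅-of-adj same
  where
  same : ∀ i j → adj (glue (mkGraph 1 A A-sym A-irr) Q c d) i j ≡ adj (apex Q d) i j
  same zero    zero    = A-irr zero
  same zero    (suc j) = cong (_∧ d j) c0≡true
  same (suc i) zero    = cong (_∧ d i) c0≡true
  same (suc i) (suc j) = refl

module _ {𝒢 : GraphClass} where

  glue-closed-smallˡ : ∀ {Q₁ Q₂ d₁ d₂} → n Q₁ ≤ 1 →
                       Closure 𝒢 Q₁ → Closure 𝒢 Q₂ → Closure 𝒢 (apex Q₂ d₂) →
                       Closure 𝒢 (glue Q₁ Q₂ d₁ d₂)
  glue-closed-smallˡ {mkGraph 0 A A-sym A-irr} {Q₂} {d₁} {d₂} _ _ q₂ _ =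
    iso q₂ (glue-emptyˡ {A} {A-sym} {A-irr} Q₂ d₁ d₂)
  glue-closed-smallˡ {mkGraph 1 _ _ _} {Q₂} {d₁} {d₂} _ q₁ q₂ a₂ with d₁ zero in d₁0
  ... | false = iso (union q₁ q₂) (glue-isolatedˡ Q₂ d₁ d₂ d₁0)
  ... | true  = iso a₂ (glue-apexˡ Q₂ d₁ d₂ d₁0)
  glue-closed-smallˡ {mkGraph (suc (suc _)) _ _ _} (s≤s ())

  glue-closed : ∀ {Q₁ Q₂ d₁ d₂} → Closure 𝒢 Q₁ → Closure 𝒢 Q₂ →
                Closure 𝒢 (apex Q₁ d₁) → Closure 𝒢 (apex Q₂ d₂) →
                Closure 𝒢 (glue Q₁ Q₂ d₁ d₂)
  glue-closed {Q₁} {Q₂} {d₁} {d₂} q₁ q₂ a₁ a₂ with n Q₁ ≤? 1 | n Q₂ ≤? 1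
  ... | yes small₁ | _          = glue-closed-smallˡ small₁ q₁ q₂ a₂
  ... | no _       | yes small₂ = iso (glue-closed-smallˡ small₂ q₂ q₁ a₁) (glue-comm Q₂ Q₁ d₂ d₁)
  ... | no big₁    | no big₂    =
    iso (join a₁ a₂ (s≤s (≰⇒> big₁)) (s≤s (≰⇒> big₂)) zero zero) (oneJoin-apex Q₁ Q₂ d₁ d₂)

  closure-induced : Hereditary 𝒢 → ∀ {G} → Closure 𝒢 G →
                    ∀ {k} (e : Fin k ↣ Fin (n G)) → Closure 𝒢 (induced G e)
  closure-induced hered (base {G} g) e = base (hered G g e (induced G e) (≅-refl (induced G e)))
  closure-induced hered (iso {G} {G′} c φ) e =
    iso (closure-induced hered c (↔⇒↣ (↔-sym (proj₁ φ)) ↣-∘ e)) (induced-≅ G G′ φ e)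
  closure-induced hered (union {G₁} {G₂} c₁ c₂) e =
    iso (union (closure-induced hered c₁ e₁) (closure-induced hered c₂ e₂)) decomposition
    where open GlueOfInduced (induced-glue G₁ G₂ (λ _ → false) (λ _ → false) e)
  closure-induced hered (join {G₁} {G₂} c₁ c₂ _ _ v₁ v₂) e =
    iso (glue-closed part₁ part₂ apex₁ apex₂) decomposition
    where
    open GlueOfInduced (induced-glue (delete G₁ v₁) (delete G₂ v₂) (nbrOf G₁ v₁) (nbrOf G₂ v₂) e)
    part₁ : Closure 𝒢 (induced (delete G₁ v₁) e₁)
    part₁ = iso (closure-induced hered c₁ (delete↣ G₁ v₁ ↣-∘ e₁)) (induced-delete G₁ v₁ e₁)
    part₂ : Closure 𝒢 (induced (delete G₂ v₂) e₂)
    part₂ = iso (closure-induced hered c₂ (delete↣ G₂ v₂ ↣-∘ e₂)) (induced-delete G₂ v₂ e₂)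
    apex₁ : Closure 𝒢 (apex (induced (delete G₁ v₁) e₁) (nbrOf G₁ v₁ ∘ Injection.to e₁))
    apex₁ = iso (closure-induced hered c₁ (restore↣ G₁ v₁ e₁)) (induced-restore G₁ v₁ e₁)
    apex₂ : Closure 𝒢 (apex (induced (delete G₂ v₂) e₂) (nbrOf G₂ v₂ ∘ Injection.to e₂))
    apex₂ = iso (closure-induced hered c₂ (restore↣ G₂ v₂ e₂)) (induced-restore G₂ v₂ e₂)

lemma2p1 : (𝒢 : GraphClass) → Hereditary 𝒢 → Hereditary (Closure 𝒢)
lemma2p1 𝒢 hered G G∈ e H H≅ = iso (closure-induced hered G∈ e) (≅-sym H (induced G e) H≅)
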